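{- Let $f=c_1x_1^k+c_2x_2^k+\cdots+c_tx_t^k$ with $c_1,\ldots,c_t\in\mathbb{Z}$, $k\geq 1$, let $p$ be a prime not dividing any of $c_1,\ldots,c_t$, and let $p^s$ be the highest power of $p$ dividing $k$. If $2s+2\leq n\leq k+1$, then \[N_{p^n}\subseteq\{jp^{n-1}: 0<j<p\}.\] Moreover, if $2s+2\leq k+1$, then \[N_{p^{k+1}}\subseteq\{jp^k: 0<j<p,\ j\notin A_p\},\] and if in addition some exponent of $p$ in $f$ divides $k$, then \[N_{p^{k+1}}=\{jp^k: 0<j<p,\ j\notin A_p\}.\]
   Context: For a positive integer $n$, $I_n=\{0,1,\ldots,n-1\}$ and $A_n$ is the set of $a\in I_n$ such that $f(x_1,\ldots,x_t)\equiv a\pmod n$ has an integer solution. For $m\mid n$, $A_n(m)=\{a+jm: a\in A_m,\ 0\leq j<n/m\}$. For $n\geq 1$, $N_{p^n}=A_{p^n}(p^{n-1})\setminus A_{p^n}$. A nonnegative integer $e$ is an exponent of $p$ in $f$ if whenever $p^e$ divides an integer of the form $f(m_1,\ldots,m_t)$, the quotient $f(m_1,\ldots,m_t)/p^e$ is also of the form $f(q_1,\ldots,q_t)$ for some integers $q_i$. -}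

module Defs where

open import Data.Nat as ℕ using (ℕ; zero; suc; _<_; _≤_; _∸_; _^_; NonZero; nonTrivial⇒nonZero)
open import Data.Nat.Properties using (m^n≢0)
open import Data.Nat.Primality using (Prime; prime⇒nonZero)
open import Data.Fin using (Fin)
open import Data.Integer as ℤ using (ℤ; +_)
open import Data.Integer.Divisibility using () renaming (_∣_ to _∣ℤ_)
open import Data.Product using (Σ; ∃; _×_)
open import Data.Vec.Functional using (Vector; foldr)
open import Relation.Nullary using (¬_)
open import Relation.Binary.PropositionalEquality using (_≡_)

diag : {t : ℕ} → (c : Fin t → ℤ) → (k : ℕ) → (x : Fin t → ℤ) → ℤ
diag {t} c k x = foldr ℤ._+_ (+ 0) (λ i → c i ℤ.* (x i ℤ.^ k))

InA : {t : ℕ} → (c : Fin t → ℤ) → (k n a : ℕ) → Set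
InA {t} c k n a = a < n × ∃ λ (x : Fin t → ℤ) → (+ n) ∣ℤ (diag c k x ℤ.- (+ a))

-- b ∈ A_n(m) = {a + j m : a ∈ A_m, 0 ≤ j < n/m}   (used with m ∣ n, m ≠ 0)
InAm : {t : ℕ} → (c : Fin t → ℤ) → (k n m : ℕ) → .{{NonZero m}} → ℕ → Set
InAm c k n m b = ∃ λ a → ∃ λ j → InA c k m a × j < n ℕ./ m × b ≡ a ℕ.+ j ℕ.* m

-- b ∈ N_{p^n} = A_{p^n}(p^{n-1}) \ A_{p^n}   (p prime, n ≥ 1)
InN : {t : ℕ} → (c : Fin t → ℤ) → (k p : ℕ) → Prime p → (n b : ℕ) → Set
InN c k p pp n b =
  InAm c k (p ^ n) (p ^ (n ∸ 1)) {{m^n≢0 p (n ∸ 1) {{nz}}}} b × ¬ InA c k (p ^ n) b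
  where
  nz : NonZero p
  nz = prime⇒nonZero pp

IsExponent : {t : ℕ} → (c : Fin t → ℤ) → (k p e : ℕ) → Set
IsExponent {t} c k p e =
  (m : Fin t → ℤ) → (+ (p ^ e)) ∣ℤ diag c k m →
  ∃ λ (q : Fin t → ℤ) → diag c k m ≡ (+ (p ^ e)) ℤ.* diag c k q

module Submission where

-- Key fact (Hensel lifting): if m ≥ 2s+1 and f(x) ≡ b (mod p^m) with some xᵢ
-- prime to p, then moving xᵢ by a multiple of p^(m−s) gives f(y) ≡ b (mod p^(m+1)).
-- Hence if b = a + j·p^m ∈ A_{p^(m+1)}(p^m) is not in A_{p^(m+1)}, a solution x of
-- f ≡ a (mod p^m) has all xᵢ divisible by p, so p^k ∣ f(x); for m ≤ k this forces
-- a = 0, i.e. b = j·p^m with 0 < j < p (part (i)).  For m = k moreover j ∉ A_p,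
-- since a solution y of f ≡ j (mod p) scales to the solution p·y of
-- f ≡ j·p^k (mod p^(k+1)) (part (ii)).  Conversely, if an exponent e of p in f
-- divides k, a solution of f ≡ j·p^k (mod p^(k+1)) has p^k ∣ f(x), and k/e uses
-- of the exponent property give f(x) = p^k·f(q) with f(q) ≡ j (mod p) (part (iii)).

module DiagonalForms where

  open import Defs
  open import Data.Nat as ℕ using (ℕ; zero; suc; NonZero)
  open import Data.Nat.Properties as ℕP using ()
  open import Data.Nat.DivMod using (m*n/n≡m)
  open import Data.Nat.Divisibility as ℕD using () renaming (_∣_ to _∣ₙ_)
  open import Data.Nat.Primality using (Prime; euclidsLemma; prime⇒irreducible; prime⇒nonZero; prime⇒nonTrivial)
  open import Data.Nat.Coprimality using (Coprime; coprime-Bézout)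
  open import Data.Nat.GCD using (module Bézout)
  open import Data.Fin using (Fin; zero; suc)
  open import Data.Fin.Properties using (all?; ¬∀⟶∃¬)
  open import Data.Integer as ℤ using (ℤ; +_; _+_; _*_; _-_; -_; _^_; ∣_∣; 0ℤ; 1ℤ)
  open import Data.Integer.Properties as ℤP using ()
  open import Data.Integer.Divisibility as Unsigned using ()
  open import Data.Integer.Divisibility.Signed
  open import Data.Integer.Tactic.RingSolver using (solve-∀)
  import Data.Nat.Tactic.RingSolver as ℕSolver
  open import Data.Vec.Functional using (updateAt)
  open import Data.Product using (∃; _×_; _,_; proj₁; proj₂)
  open import Data.Sum using (inj₁; inj₂)
  open import Data.Empty using (⊥-elim)
  open import Relation.Nullary using (¬_; yes; no)
  open import Relation.Binary.PropositionalEquality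

  pos-^ : ∀ a n → + (a ℕ.^ n) ≡ (+ a) ^ n
  pos-^ a zero    = refl
  pos-^ a (suc n) = trans (ℤP.pos-* a (a ℕ.^ n)) (cong (+ a *_) (pos-^ a n))

  pos-*-^ : ∀ j p m → + (j ℕ.* p ℕ.^ m) ≡ + j * (+ p) ^ m
  pos-*-^ j p m = trans (ℤP.pos-* j (p ℕ.^ m)) (cong (+ j *_) (pos-^ p m))

  ∣ᵤ⇒∣^ : ∀ p n {z} → + (p ℕ.^ n) Unsigned.∣ z → (+ p) ^ n ∣ z
  ∣ᵤ⇒∣^ p n {z} d = subst (_∣ z) (pos-^ p n) (∣ᵤ⇒∣ d)

  ∣^⇒∣ᵤ : ∀ p n {z} → (+ p) ^ n ∣ z → + (p ℕ.^ n) Unsigned.∣ z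
  ∣^⇒∣ᵤ p n {z} d = ∣⇒∣ᵤ (subst (_∣ z) (sym (pos-^ p n)) d)

  pos-^-nonZero : ∀ p n .{{_ : NonZero p}} → ℤ.NonZero ((+ p) ^ n)
  pos-^-nonZero p n = subst ℤ.NonZero (pos-^ p n) (ℕP.m^n≢0 p n)

  ^-distribʳ-* : ∀ a b n → (a * b) ^ n ≡ a ^ n * b ^ n
  ^-distribʳ-* a b zero    = refl
  ^-distribʳ-* a b (suc n) = begin
    a * b * (a * b) ^ n     ≡⟨ cong (a * b *_) (^-distribʳ-* a b n) ⟩
    a * b * (a ^ n * b ^ n) ≡⟨ interchange a b (a ^ n) (b ^ n) ⟩
    a * a ^ n * (b * b ^ n) ∎
    where
    open ≡-Reasoning
    interchange : ∀ a b x y → a * b * (x * y) ≡ a * x * (b * y)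
    interchange = solve-∀

  ^-mono-∣ : ∀ {d x} n → d ∣ x → d ^ n ∣ x ^ n
  ^-mono-∣ zero    d∣x = ∣-refl
  ^-mono-∣ {d} {x} (suc n) d∣x = ∣-trans (*-monoʳ-∣ d (^-mono-∣ n d∣x)) (*-monoˡ-∣ (x ^ n) d∣x)

  ^-∣-^+ : ∀ P a b → P ^ a ∣ P ^ (a ℕ.+ b)
  ^-∣-^+ P a b = divides (P ^ b) (trans (ℤP.^-distribˡ-+-* P a b) (ℤP.*-comm (P ^ a) (P ^ b)))

  binomial-step : ∀ X h k → ∃ λ Q → (X + h) ^ suc k ≡ X ^ suc k + + suc k * X ^ k * h + h * h * Q
  binomial-step X h zero = 0ℤ , base X h
    where
    base : ∀ X h → (X + h) * 1ℤ ≡ X * 1ℤ + 1ℤ * 1ℤ * h + h * h * 0ℤ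
    base = solve-∀
  binomial-step X h (suc k) with binomial-step X h k
  ... | Q , expansion = + suc k * X ^ k + (X + h) * Q , trans (cong ((X + h) *_) expansion) (multiply X h (+ suc k) (X ^ k) Q)
    where
    multiply : ∀ X h K Xᵏ Q →
      (X + h) * (X * Xᵏ + K * Xᵏ * h + h * h * Q) ≡ X * (X * Xᵏ) + (1ℤ + K) * (X * Xᵏ) * h + h * h * (K * Xᵏ + (X + h) * Q)
    multiply = solve-∀

  module _ {p : ℕ} (pp : Prime p) where

    prime∤1 : ¬ + p ∣ 1ℤ
    prime∤1 p∣1 = ℕP.<⇒≱ (ℕ.nonTrivial⇒n>1 p {{prime⇒nonTrivial pp}}) (ℕD.∣⇒≤ (∣⇒∣ᵤ p∣1))

    prime∤* : ∀ {a b} → ¬ + p ∣ a → ¬ + p ∣ b → ¬ + p ∣ a * b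
    prime∤* {a} {b} p∤a p∤b p∣ab with euclidsLemma ∣ a ∣ ∣ b ∣ pp (subst (p ∣ₙ_) (ℤP.abs-* a b) (∣⇒∣ᵤ p∣ab))
    ... | inj₁ p∣a = p∤a (∣ᵤ⇒∣ p∣a)
    ... | inj₂ p∣b = p∤b (∣ᵤ⇒∣ p∣b)

    prime∤^ : ∀ {a} n → ¬ + p ∣ a → ¬ + p ∣ a ^ n
    prime∤^ zero    p∤a = prime∤1
    prime∤^ (suc n) p∤a = prime∤* p∤a (prime∤^ n p∤a)

    prime-coprime : ∀ {n} → ¬ p ∣ₙ n → Coprime p n
    prime-coprime p∤n (d∣p , d∣n) with prime⇒irreducible pp d∣p
    ... | inj₁ d≡1 = d≡1
    ... | inj₂ refl = ⊥-elim (p∤n d∣n)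

    pos-Bézout : ∀ u v w z → 1 ℕ.+ u ℕ.* v ≡ w ℕ.* z → 1ℤ + + u * + v ≡ + w * + z
    pos-Bézout u v w z eq =
      trans (cong (λ uv → 1ℤ + uv) (sym (ℤP.pos-* u v))) (trans (cong +_ eq) (ℤP.pos-* w z))

    inverse-modℕ : ∀ {n} → ¬ p ∣ₙ n → ∃ λ α → + p ∣ α * + n - 1ℤ
    inverse-modℕ {n} p∤n with coprime-Bézout (prime-coprime p∤n)
    ... | Bézout.+- x y 1+yn≡xp = - + y , divides (- + x) (begin
      - + y * + n - 1ℤ     ≡⟨ negate (+ y) (+ n) ⟩
      - (1ℤ + + y * + n)   ≡⟨ cong -_ (pos-Bézout y n x p 1+yn≡xp) ⟩
      - (+ x * + p)        ≡⟨ ℤP.neg-distribˡ-* (+ x) (+ p) ⟩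
      - + x * + p          ∎)
      where
      open ≡-Reasoning
      negate : ∀ y n → - y * n - 1ℤ ≡ - (1ℤ + y * n)
      negate = solve-∀
    ... | Bézout.-+ x y 1+xp≡yn = + y , divides (+ x) (begin
      + y * + n - 1ℤ           ≡⟨ cong (_- 1ℤ) (sym (pos-Bézout x p y n 1+xp≡yn)) ⟩
      1ℤ + + x * + p - 1ℤ      ≡⟨ cancel (+ x * + p) ⟩
      + x * + p                ∎)
      where
      open ≡-Reasoning
      cancel : ∀ a → 1ℤ + a - 1ℤ ≡ a
      cancel = solve-∀

    inverse-mod : ∀ {a} → ¬ + p ∣ a → ∃ λ α → + p ∣ α * a - 1ℤ
    inverse-mod {a} p∤a with inverse-modℕ {∣ a ∣} (λ p∣∣a∣ → p∤a (∣ᵤ⇒∣ p∣∣a∣)) | ℤP.+∣i∣≡i⊎+∣i∣≡-i a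
    ... | α , inverse | inj₁ +∣a∣≡a  = α , subst (λ v → + p ∣ α * v - 1ℤ) +∣a∣≡a inverse
    ... | α , inverse | inj₂ +∣a∣≡-a = - α , subst (λ v → + p ∣ v - 1ℤ) (trans (cong (α *_) +∣a∣≡-a) (swap-sign α a)) inverse
      where
      swap-sign : ∀ α a → α * - a ≡ - α * a
      swap-sign = solve-∀

  diag-zero : ∀ {t} (c : Fin t → ℤ) k → 1 ℕ.≤ k → diag c k (λ _ → 0ℤ) ≡ 0ℤ
  diag-zero {zero}  c k       _ = refl
  diag-zero {suc t} c (suc k) _ =
    cong₂ _+_ (ℤP.*-zeroʳ (c zero)) (diag-zero (λ i → c (suc i)) (suc k) (ℕ.s≤s ℕ.z≤n))

  diag-scale : ∀ {t} (c : Fin t → ℤ) k z (y : Fin t → ℤ) → diag c k (λ i → z * y i) ≡ z ^ k * diag c k y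
  diag-scale {zero}  c k z y = sym (ℤP.*-zeroʳ (z ^ k))
  diag-scale {suc t} c k z y = begin
    c zero * (z * y zero) ^ k + diag c′ k (λ i → z * y′ i)
      ≡⟨ cong₂ (λ u v → c zero * u + v) (^-distribʳ-* z (y zero) k) (diag-scale c′ k z y′) ⟩
    c zero * (z ^ k * y zero ^ k) + z ^ k * diag c′ k y′
      ≡⟨ factor-out (c zero) (z ^ k) (y zero ^ k) (diag c′ k y′) ⟩
    z ^ k * (c zero * y zero ^ k + diag c′ k y′) ∎
    where
    open ≡-Reasoning
    c′ y′ : Fin t → ℤ
    c′ i = c (suc i)
    y′ i = y (suc i)
    factor-out : ∀ c Z Y D → c * (Z * Y) + Z * D ≡ Z * (c * Y + D)
    factor-out = solve-∀

  diag-divisible : ∀ {t} (c : Fin t → ℤ) k {d} (x : Fin t → ℤ) → (∀ i → d ∣ x i) → d ^ k ∣ diag c k x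
  diag-divisible {zero}  c k {d} x d∣x = divides 0ℤ (sym (ℤP.*-zeroˡ (d ^ k)))
  diag-divisible {suc t} c k     x d∣x =
    ∣m∣n⇒∣m+n (∣n⇒∣m*n (c zero) (^-mono-∣ k (d∣x zero)))
              (diag-divisible (λ i → c (suc i)) k (λ i → x (suc i)) (λ i → d∣x (suc i)))

  diag-updateAt : ∀ {t} (c : Fin t → ℤ) k (x : Fin t → ℤ) i g →
    diag c k (updateAt x i g) ≡ diag c k x + c i * (g (x i) ^ k - x i ^ k)
  diag-updateAt {suc t} c k x zero g =
    change-head (c zero) (g (x zero) ^ k) (x zero ^ k) (diag (λ i → c (suc i)) k (λ i → x (suc i)))
    where
    change-head : ∀ c Y X D → c * Y + D ≡ c * X + D + c * (Y - X)
    change-head = solve-∀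
  diag-updateAt {suc t} c k x (suc i) g =
    trans (cong (λ D → c zero * x zero ^ k + D) (diag-updateAt (λ j → c (suc j)) k (λ j → x (suc j)) i g))
          (sym (ℤP.+-assoc (c zero * x zero ^ k) _ _))

  diag-perturb : ∀ {t} (c : Fin t → ℤ) k₀ (x : Fin t → ℤ) i h → ∃ λ Q →
    diag c (suc k₀) (updateAt x i (_+ h)) ≡ diag c (suc k₀) x + c i * (+ suc k₀ * x i ^ k₀ * h) + c i * (h * h * Q)
  diag-perturb c k₀ x i h = Q , (begin
    diag c (suc k₀) (updateAt x i (_+ h))
      ≡⟨ diag-updateAt c (suc k₀) x i (_+ h) ⟩
    diag c (suc k₀) x + c i * ((x i + h) ^ suc k₀ - x i ^ suc k₀)
      ≡⟨ cong (λ v → diag c (suc k₀) x + c i * (v - x i ^ suc k₀)) expansion ⟩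
    diag c (suc k₀) x + c i * (x i ^ suc k₀ + + suc k₀ * x i ^ k₀ * h + h * h * Q - x i ^ suc k₀)
      ≡⟨ cancel-top (diag c (suc k₀) x) (c i) (x i ^ suc k₀) (+ suc k₀ * x i ^ k₀ * h) (h * h * Q) ⟩
    diag c (suc k₀) x + c i * (+ suc k₀ * x i ^ k₀ * h) + c i * (h * h * Q) ∎)
    where
    open ≡-Reasoning
    Q : ℤ
    Q = proj₁ (binomial-step (x i) h k₀)
    expansion : (x i + h) ^ suc k₀ ≡ x i ^ suc k₀ + + suc k₀ * x i ^ k₀ * h + h * h * Q
    expansion = proj₂ (binomial-step (x i) h k₀)
    cancel-top : ∀ D C Y L H → D + C * (Y + L + H - Y) ≡ D + C * L + C * H
    cancel-top = solve-∀

  -- Let k = k₀ + 1 = q·p^s with p ∤ q, and m = s + (s + 1 + e), so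
  -- that m ranges over all m ≥ 2s + 1.  If f(x) ≡ b (mod p^m) and both xᵢ and cᵢ are
  -- prime to p, replace xᵢ by xᵢ + h with h = p^(s+1+e)·u.  The linear term of
  -- f(y) − f(x) is A·u·p^m with A = cᵢ·q·xᵢ^(k−1) a unit mod p, so a suitable u
  -- cancels f(x) − b modulo p^(m+1); the quadratic term is a multiple of h², which
  -- p^(m+1) divides exactly because m ≥ 2s + 1.
  hensel-lift : ∀ {t} (c : Fin t → ℤ) k₀ {p} → Prime p → (s : ℕ) (q : ℤ) →
    + suc k₀ ≡ q * (+ p) ^ s → ¬ + p ∣ q → (e : ℕ) (x : Fin t → ℤ) (i : Fin t) →
    ¬ + p ∣ c i → ¬ + p ∣ x i → (b : ℤ) →
    (+ p) ^ (s ℕ.+ suc (s ℕ.+ e)) ∣ diag c (suc k₀) x - b →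
    ∃ λ y → (+ p) ^ suc (s ℕ.+ suc (s ℕ.+ e)) ∣ diag c (suc k₀) y - b
  hensel-lift c k₀ {p} pp s q k≡qpˢ p∤q e x i p∤cᵢ p∤xᵢ b (divides w f[x]-b≡wpᵐ) =
    updateAt x i (_+ h) , subst (P ^ suc m ∣_) (sym split) (∣m∣n⇒∣m+n linear-part quadratic-part)
    where
    open ≡-Reasoning
    P : ℤ
    P = + p
    k m : ℕ
    k = suc k₀
    m = s ℕ.+ suc (s ℕ.+ e)
    T : ℤ
    T = P ^ suc (s ℕ.+ e)
    pᵐ≡pˢT : P ^ m ≡ P ^ s * T
    pᵐ≡pˢT = ℤP.^-distribˡ-+-* P s (suc (s ℕ.+ e))
    A : ℤ
    A = c i * q * x i ^ k₀
    A-unit : ∃ λ α → P ∣ α * A - 1ℤ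
    A-unit = inverse-mod pp (prime∤* pp (prime∤* pp p∤cᵢ p∤q) (prime∤^ pp k₀ p∤xᵢ))
    α z u h : ℤ
    α = proj₁ A-unit
    z = _∣_.quotient (proj₂ A-unit)
    u = - (w * α)
    h = T * u
    αA-1≡zP : α * A - 1ℤ ≡ z * P
    αA-1≡zP = _∣_.equality (proj₂ A-unit)
    Q : ℤ
    Q = proj₁ (diag-perturb c k₀ x i h)

    split : diag c k (updateAt x i (_+ h)) - b ≡ (diag c k x - b + c i * (+ k * x i ^ k₀ * h)) + c i * u * u * Q * (T * T)
    split = trans (cong (_- b) (proj₂ (diag-perturb c k₀ x i h)))
                  (regroup (diag c k x) b (c i) (+ k * x i ^ k₀ * h) T u Q)
      where
      regroup : ∀ D B C L T u Q → D + C * L + C * (T * u * (T * u) * Q) - B ≡ (D - B + C * L) + C * u * u * Q * (T * T)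
      regroup = solve-∀

    -- As k = q·p^s and h = p^(s+1+e)·u, the linear term is A·u·p^m, and the choice
    -- u = −w·α turns the sum into −w·p^m·(α·A − 1) ≡ 0 (mod p^(m+1)).
    linear-part : P ^ suc m ∣ diag c k x - b + c i * (+ k * x i ^ k₀ * h)
    linear-part = divides (- (w * z)) (begin
      diag c k x - b + c i * (+ k * x i ^ k₀ * h)
        ≡⟨ cong₂ (λ E K → E + c i * (K * x i ^ k₀ * h)) f[x]-b≡wpᵐ k≡qpˢ ⟩
      w * P ^ m + c i * (q * P ^ s * x i ^ k₀ * (T * - (w * α)))
        ≡⟨ cong (λ M → w * M + c i * (q * P ^ s * x i ^ k₀ * (T * - (w * α)))) pᵐ≡pˢT ⟩
      w * (P ^ s * T) + c i * (q * P ^ s * x i ^ k₀ * (T * - (w * α)))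
        ≡⟨ factor w (c i) q (P ^ s) (x i ^ k₀) T α ⟩
      - (w * (α * A - 1ℤ)) * (P ^ s * T)
        ≡⟨ cong (λ v → - (w * v) * (P ^ s * T)) αA-1≡zP ⟩
      - (w * (z * P)) * (P ^ s * T)
        ≡⟨ regroup w z P (P ^ s * T) ⟩
      - (w * z) * (P * (P ^ s * T))
        ≡⟨ cong (λ M → - (w * z) * (P * M)) (sym pᵐ≡pˢT) ⟩
      - (w * z) * (P * P ^ m) ∎)
      where
      factor : ∀ w C q S Xᵏ⁻¹ T α → w * (S * T) + C * (q * S * Xᵏ⁻¹ * (T * - (w * α))) ≡ - (w * (α * (C * q * Xᵏ⁻¹) - 1ℤ)) * (S * T)
      factor = solve-∀
      regroup : ∀ w z P M → - (w * (z * P)) * M ≡ - (w * z) * (P * M)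
      regroup = solve-∀

    -- T² = p^(2(s+1+e)) and 2(s+1+e) = (m + 1) + e, so p^(m+1) divides the h² term.
    quadratic-part : P ^ suc m ∣ c i * u * u * Q * (T * T)
    quadratic-part = ∣n⇒∣m*n (c i * u * u * Q)
      (subst (P ^ suc m ∣_) (trans (cong (P ^_) (double s e)) (ℤP.^-distribˡ-+-* P (suc (s ℕ.+ e)) (suc (s ℕ.+ e))))
             (^-∣-^+ P (suc m) e))
      where
      double : ∀ s e → suc (s ℕ.+ suc (s ℕ.+ e)) ℕ.+ e ≡ suc (s ℕ.+ e) ℕ.+ suc (s ℕ.+ e)
      double = ℕSolver.solve-∀

  exponent-iterate : ∀ {t} (c : Fin t → ℤ) k {p e} → .{{NonZero p}} → IsExponent c k p e →
    ∀ d (x : Fin t → ℤ) → (+ p) ^ (d ℕ.* e) ∣ diag c k x →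
    ∃ λ q → diag c k x ≡ (+ p) ^ (d ℕ.* e) * diag c k q
  exponent-iterate c k is-exp zero    x _ = x , sym (ℤP.*-identityˡ (diag c k x))
  exponent-iterate {t} c k {p} {e} is-exp (suc d) x pᵉ⁺ᵈᵉ∣f[x] = q , (begin
    diag c k x                                ≡⟨ f[x]≡pᵉf[q₁] ⟩
    P ^ e * diag c k q₁                       ≡⟨ cong (P ^ e *_) f[q₁]≡pᵈᵉf[q] ⟩
    P ^ e * (P ^ (d ℕ.* e) * diag c k q)      ≡⟨ sym (ℤP.*-assoc (P ^ e) (P ^ (d ℕ.* e)) (diag c k q)) ⟩
    P ^ e * P ^ (d ℕ.* e) * diag c k q        ≡⟨ cong (_* diag c k q) (sym (ℤP.^-distribˡ-+-* P e (d ℕ.* e))) ⟩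
    P ^ (e ℕ.+ d ℕ.* e) * diag c k q          ∎)
    where
    open ≡-Reasoning
    P : ℤ
    P = + p
    first-step : ∃ λ q₁ → diag c k x ≡ + (p ℕ.^ e) * diag c k q₁
    first-step = is-exp x (∣^⇒∣ᵤ p e (∣-trans (^-∣-^+ P e (d ℕ.* e)) pᵉ⁺ᵈᵉ∣f[x]))
    q₁ : Fin t → ℤ
    q₁ = proj₁ first-step
    f[x]≡pᵉf[q₁] : diag c k x ≡ P ^ e * diag c k q₁
    f[x]≡pᵉf[q₁] = trans (proj₂ first-step) (cong (_* diag c k q₁) (pos-^ p e))
    pᵈᵉ∣f[q₁] : P ^ (d ℕ.* e) ∣ diag c k q₁
    pᵈᵉ∣f[q₁] = *-cancelˡ-∣ (P ^ e) {{pos-^-nonZero p e}}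
      (subst₂ _∣_ (ℤP.^-distribˡ-+-* P e (d ℕ.* e)) f[x]≡pᵉf[q₁] pᵉ⁺ᵈᵉ∣f[x])
    rest : ∃ λ q → diag c k q₁ ≡ P ^ (d ℕ.* e) * diag c k q
    rest = exponent-iterate c k is-exp d q₁ pᵈᵉ∣f[q₁]
    q : Fin t → ℤ
    q = proj₁ rest
    f[q₁]≡pᵈᵉf[q] : diag c k q₁ ≡ P ^ (d ℕ.* e) * diag c k q
    f[q₁]≡pᵈᵉf[q] = proj₂ rest

  pos-digits : ∀ a j p m → + (a ℕ.+ j ℕ.* p ℕ.^ m) ≡ + a + + j * (+ p) ^ m
  pos-digits a j p m =
    trans (ℤP.pos-+ a (j ℕ.* p ℕ.^ m)) (cong (λ v → + a + v) (pos-*-^ j p m))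

  shift-residue : ∀ p m D a j → (+ p) ^ m ∣ D - + a → (+ p) ^ m ∣ D - + (a ℕ.+ j ℕ.* p ℕ.^ m)
  shift-residue p m D a j pᵐ∣D-a = subst ((+ p) ^ m ∣_) (sym rearrange)
    (∣m∣n⇒∣m-n pᵐ∣D-a (∣n⇒∣m*n (+ j) ∣-refl))
    where
    shift : ∀ D a j M → D - (a + j * M) ≡ D - a - j * M
    shift = solve-∀
    rearrange : D - + (a ℕ.+ j ℕ.* p ℕ.^ m) ≡ D - + a - + j * (+ p) ^ m
    rearrange = trans (cong (λ v → D - v) (pos-digits a j p m)) (shift D (+ a) (+ j) ((+ p) ^ m))

  ∣∧<⇒≡0 : ∀ {a n} → n ∣ₙ a → a ℕ.< n → a ≡ 0
  ∣∧<⇒≡0 {zero}  _   _   = refl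
  ∣∧<⇒≡0 {suc a} n∣a a<n = ⊥-elim (ℕP.<⇒≱ a<n (ℕD.∣⇒≤ n∣a))

  digits-< : ∀ p m {a j} → a ℕ.< p ℕ.^ m → j ℕ.< p → a ℕ.+ j ℕ.* p ℕ.^ m ℕ.< p ℕ.^ suc m
  digits-< p m {a} {j} a<pᵐ j<p =
    ℕP.≤-trans (ℕP.+-monoˡ-< (j ℕ.* p ℕ.^ m) a<pᵐ) (ℕP.*-monoˡ-≤ (p ℕ.^ m) j<p)

  blocks : ∀ p m .{{_ : NonZero p}} → ℕ._/_ (p ℕ.^ suc m) (p ℕ.^ m) {{ℕP.m^n≢0 p m}} ≡ p
  blocks p m = m*n/n≡m p (p ℕ.^ m) {{ℕP.m^n≢0 p m}}

  zero∈A : ∀ {t} (c : Fin t → ℤ) k n → 1 ℕ.≤ k → 0 ℕ.< n → InA c k n 0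
  zero∈A c k n k≥1 n>0 = n>0 , (λ _ → 0ℤ) , ∣⇒∣ᵤ {+ n} (divides 0ℤ (cong (_- + 0) (diag-zero c k k≥1)))

  -- A digit j with j·p^m ∉ A_{p^(m+1)} is nonzero, as 0 ∈ A_{p^(m+1)}.
  positive-digit : ∀ {t} (c : Fin t → ℤ) k p m .{{_ : NonZero p}} → 1 ℕ.≤ k →
    ∀ j → ¬ InA c k (p ℕ.^ suc m) (j ℕ.* p ℕ.^ m) → 0 ℕ.< j
  positive-digit c k p m k≥1 zero    0∉A = ⊥-elim (0∉A (zero∈A c k _ k≥1 (ℕ.>-nonZero⁻¹ _ {{ℕP.m^n≢0 p (suc m)}})))
  positive-digit c k p m k≥1 (suc j) _   = ℕ.s≤s ℕ.z≤n

  -- If every coordinate of x is divisible by p and m ≤ k, then p^m ∣ p^k ∣ f(x), so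
  -- f(x) ≡ a (mod p^m) with 0 ≤ a < p^m forces a = 0.
  non-unit-residue : ∀ {t} (c : Fin t → ℤ) k {p m a} (x : Fin t → ℤ) → (∀ i → + p ∣ x i) → m ℕ.≤ k →
    (+ p) ^ m ∣ diag c k x - + a → a ℕ.< p ℕ.^ m → a ≡ 0
  non-unit-residue c k {p} {m} {a} x p∣x m≤k pᵐ∣f[x]-a a<pᵐ = ∣∧<⇒≡0 (∣^⇒∣ᵤ p m pᵐ∣a) a<pᵐ
    where
    pᵐ∣pᵏ : (+ p) ^ m ∣ (+ p) ^ k
    pᵐ∣pᵏ = subst (λ n → (+ p) ^ m ∣ (+ p) ^ n) (proj₂ (ℕP.m≤n⇒∃[o]m+o≡n m≤k)) (^-∣-^+ (+ p) m _)
    pᵐ∣f[x] : (+ p) ^ m ∣ diag c k x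
    pᵐ∣f[x] = ∣-trans pᵐ∣pᵏ (diag-divisible c k x p∣x)
    cancel : ∀ D a → D - (D - a) ≡ a
    cancel = solve-∀
    pᵐ∣a : (+ p) ^ m ∣ + a
    pᵐ∣a = subst ((+ p) ^ m ∣_) (cancel (diag c k x) (+ a)) (∣m∣n⇒∣m-n pᵐ∣f[x] pᵐ∣f[x]-a)

  factor-left : ∀ M F J → M * F - J * M ≡ M * (F - J)
  factor-left = solve-∀

  -- Scaling by p: if f(y) ≡ j (mod p) then f(p·y) = p^k·f(y) ≡ j·p^k (mod p^(k+1)).
  scale-solution : ∀ {t} (c : Fin t → ℤ) k {p j} .{{_ : NonZero p}} →
    InA c k p j → InA c k (p ℕ.^ suc k) (j ℕ.* p ℕ.^ k)
  scale-solution c k {p} {j} (j<p , y , p∣f[y]-j) =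
    ℕP.*-monoˡ-< (p ℕ.^ k) {{ℕP.m^n≢0 p k}} j<p , (λ i → P * y i) , ∣^⇒∣ᵤ p (suc k) pᵏ⁺¹∣f[py]-jpᵏ
    where
    open ≡-Reasoning
    P : ℤ
    P = + p
    f[py]-jpᵏ : diag c k (λ i → P * y i) - + (j ℕ.* p ℕ.^ k) ≡ P ^ k * (diag c k y - + j)
    f[py]-jpᵏ = begin
      diag c k (λ i → P * y i) - + (j ℕ.* p ℕ.^ k)
        ≡⟨ cong₂ _-_ (diag-scale c k P y) (pos-*-^ j p k) ⟩
      P ^ k * diag c k y - + j * P ^ k
        ≡⟨ factor-left (P ^ k) (diag c k y) (+ j) ⟩
      P ^ k * (diag c k y - + j) ∎
    pᵏ⁺¹∣f[py]-jpᵏ : P ^ suc k ∣ diag c k (λ i → P * y i) - + (j ℕ.* p ℕ.^ k)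
    pᵏ⁺¹∣f[py]-jpᵏ = subst₂ _∣_ (ℤP.*-comm (P ^ k) P) (sym f[py]-jpᵏ) (*-monoʳ-∣ (P ^ k) (∣ᵤ⇒∣ p∣f[y]-j))

  -- If an exponent e of p in f divides k, then j ∉ A_p implies j·p^k ∉ A_{p^(k+1)}:
  -- a solution x of f ≡ j·p^k (mod p^(k+1)) has p^k ∣ f(x), hence f(x) = p^k·f(q)
  -- by the exponent property, and then f(q) ≡ j (mod p).
  exponent-excludes : ∀ {t} (c : Fin t → ℤ) k {p e j} .{{_ : NonZero p}} → IsExponent c k p e → e ∣ₙ k →
    j ℕ.< p → ¬ InA c k p j → ¬ InA c k (p ℕ.^ suc k) (j ℕ.* p ℕ.^ k)
  exponent-excludes {t} c k {p} {e} {j} is-exp (ℕD.divides d k≡de) j<p j∉A (_ , x , pᵏ⁺¹∣ᵤf[x]-jpᵏ) =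
    j∉A (j<p , q , ∣⇒∣ᵤ p∣f[q]-j)
    where
    P : ℤ
    P = + p
    pᵏ⁺¹∣f[x]-jpᵏ : P ^ suc k ∣ diag c k x - + j * P ^ k
    pᵏ⁺¹∣f[x]-jpᵏ = subst (λ v → P ^ suc k ∣ diag c k x - v) (pos-*-^ j p k) (∣ᵤ⇒∣^ p (suc k) pᵏ⁺¹∣ᵤf[x]-jpᵏ)
    add-back : ∀ D J → D - J + J ≡ D
    add-back = solve-∀
    pᵏ∣f[x] : P ^ k ∣ diag c k x
    pᵏ∣f[x] = subst (P ^ k ∣_) (add-back (diag c k x) (+ j * P ^ k))
      (∣m∣n⇒∣m+n (∣-trans (∣n⇒∣m*n P ∣-refl) pᵏ⁺¹∣f[x]-jpᵏ) (∣n⇒∣m*n (+ j) ∣-refl))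
    quotient-form : ∃ λ q → diag c k x ≡ P ^ (d ℕ.* e) * diag c k q
    quotient-form = exponent-iterate c k is-exp d x (subst (λ n → P ^ n ∣ diag c k x) k≡de pᵏ∣f[x])
    q : Fin t → ℤ
    q = proj₁ quotient-form
    f[x]-jpᵏ≡ : diag c k x - + j * P ^ k ≡ P ^ k * (diag c k q - + j)
    f[x]-jpᵏ≡ = trans (cong (λ D → D - + j * P ^ k) (trans (proj₂ quotient-form) (cong (λ n → P ^ n * diag c k q) (sym k≡de))))
                      (factor-left (P ^ k) (diag c k q) (+ j))
    p∣f[q]-j : P ∣ diag c k q - + j
    p∣f[q]-j = *-cancelˡ-∣ (P ^ k) {{pos-^-nonZero p k}}
      (subst₂ _∣_ (ℤP.*-comm P (P ^ k)) f[x]-jpᵏ≡ pᵏ⁺¹∣f[x]-jpᵏ)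

  exact-power : ∀ p s {k} → p ℕ.^ s ∣ₙ k → ¬ p ℕ.^ suc s ∣ₙ k → ∃ λ q → + k ≡ q * (+ p) ^ s × ¬ + p ∣ q
  exact-power p s {k} (ℕD.divides q k≡qpˢ) pˢ⁺¹∤k = + q , trans (cong +_ k≡qpˢ) (pos-*-^ q p s) , p∤q
    where
    p∤q : ¬ + p ∣ + q
    p∤q p∣q with ∣⇒∣ᵤ p∣q
    ... | ℕD.divides r q≡rp =
      pˢ⁺¹∤k (ℕD.divides r (trans k≡qpˢ (trans (cong (ℕ._* p ℕ.^ s) q≡rp) (ℕP.*-assoc r p (p ℕ.^ s)))))

  -- The levels n ≥ 2s + 2 are exactly the successors of the lifting levels s + (s + 1 + e).
  lifting-level : ∀ s n → 2 ℕ.* s ℕ.+ 2 ℕ.≤ n → ∃ λ e → n ≡ suc (s ℕ.+ suc (s ℕ.+ e))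
  lifting-level s n 2s+2≤n with ℕP.m≤n⇒∃[o]m+o≡n 2s+2≤n
  ... | e , 2s+2+e≡n = e , trans (sym 2s+2+e≡n) (regroup s e)
    where
    regroup : ∀ s e → 2 ℕ.* s ℕ.+ 2 ℕ.+ e ≡ suc (s ℕ.+ suc (s ℕ.+ e))
    regroup = ℕSolver.solve-∀

  module Parts {t} (c : Fin t → ℤ) (k₀ : ℕ) {p} (pp : Prime p) (s : ℕ)
               (pˢ∣k : p ℕ.^ s ∣ₙ suc k₀) (pˢ⁺¹∤k : ¬ p ℕ.^ suc s ∣ₙ suc k₀)
               (p∤c : ∀ i → ¬ + p Unsigned.∣ c i) where

    private
      k : ℕ
      k = suc k₀

      instance
        p≢0 : NonZero p
        p≢0 = prime⇒nonZero pp

      k+1≡1+k : k ℕ.+ 1 ≡ suc k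
      k+1≡1+k = ℕP.+-comm k 1

      cofactor : ∃ λ q → + k ≡ q * (+ p) ^ s × ¬ + p ∣ q
      cofactor = exact-power p s pˢ∣k pˢ⁺¹∤k

      p∤cᵢ : ∀ i → ¬ + p ∣ c i
      p∤cᵢ i p∣cᵢ = p∤c i (∣⇒∣ᵤ p∣cᵢ)

    -- For m = s + (s + 1 + e) ≤ k, every b ∈ N_{p^(m+1)} is j·p^m with 0 < j < p:
    -- write b = a + j·p^m with f(x) ≡ a (mod p^m); a unit coordinate of x would lift
    -- to b ∈ A_{p^(m+1)}, so all coordinates are divisible by p and a = 0.
    N-digits : ∀ e → s ℕ.+ suc (s ℕ.+ e) ℕ.≤ k → ∀ b → InN c k p pp (suc (s ℕ.+ suc (s ℕ.+ e))) b →
      ∃ λ j → 0 ℕ.< j × j ℕ.< p × b ≡ j ℕ.* p ℕ.^ (s ℕ.+ suc (s ℕ.+ e))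
    N-digits e m≤k b ((a , j , (a<pᵐ , x , pᵐ∣ᵤf[x]-a) , j<blocks , b≡a+jpᵐ) , b∉A)
      with all? (λ i → + p ∣? x i)
    ... | no ¬p∣x = ⊥-elim (b∉A (b<pᵐ⁺¹ , proj₁ lifted , ∣^⇒∣ᵤ p (suc m) (proj₂ lifted)))
      where
      m : ℕ
      m = s ℕ.+ suc (s ℕ.+ e)
      unit : ∃ λ i → ¬ + p ∣ x i
      unit = ¬∀⟶∃¬ t (λ i → + p ∣ x i) (λ i → + p ∣? x i) ¬p∣x
      pᵐ∣f[x]-b : (+ p) ^ m ∣ diag c k x - + b
      pᵐ∣f[x]-b = subst (λ v → (+ p) ^ m ∣ diag c k x - + v) (sym b≡a+jpᵐ)
                        (shift-residue p m (diag c k x) a j (∣ᵤ⇒∣^ p m pᵐ∣ᵤf[x]-a))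
      lifted : ∃ λ y → (+ p) ^ suc m ∣ diag c k y - + b
      lifted = hensel-lift c k₀ pp s (proj₁ cofactor) (proj₁ (proj₂ cofactor)) (proj₂ (proj₂ cofactor))
                           e x (proj₁ unit) (p∤cᵢ (proj₁ unit)) (proj₂ unit) (+ b) pᵐ∣f[x]-b
      b<pᵐ⁺¹ : b ℕ.< p ℕ.^ suc m
      b<pᵐ⁺¹ = subst (ℕ._< p ℕ.^ suc m) (sym b≡a+jpᵐ) (digits-< p m a<pᵐ (subst (j ℕ.<_) (blocks p m) j<blocks))
    ... | yes p∣x = j , positive-digit c k p m (ℕ.s≤s ℕ.z≤n) j (subst (λ v → ¬ InA c k (p ℕ.^ suc m) v) b≡jpᵐ b∉A)
                      , subst (j ℕ.<_) (blocks p m) j<blocks , b≡jpᵐ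
      where
      m : ℕ
      m = s ℕ.+ suc (s ℕ.+ e)
      a≡0 : a ≡ 0
      a≡0 = non-unit-residue c k x p∣x m≤k (∣ᵤ⇒∣^ p m pᵐ∣ᵤf[x]-a) a<pᵐ
      b≡jpᵐ : b ≡ j ℕ.* p ℕ.^ m
      b≡jpᵐ = trans b≡a+jpᵐ (cong (ℕ._+ j ℕ.* p ℕ.^ m) a≡0)

    part-i : (n : ℕ) → 2 ℕ.* s ℕ.+ 2 ℕ.≤ n → n ℕ.≤ k ℕ.+ 1 →
      ∀ b → InN c k p pp n b → ∃ λ j → 0 ℕ.< j × j ℕ.< p × b ≡ j ℕ.* p ℕ.^ (n ℕ.∸ 1)
    part-i n 2s+2≤n n≤k+1 with lifting-level s n 2s+2≤n
    ... | e , refl = N-digits e (ℕP.≤-pred (subst (n ℕ.≤_) k+1≡1+k n≤k+1))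

    -- Part (ii): N_{p^(k+1)} ⊆ {j·p^k : 0 < j < p, j ∉ A_p}; the digit j lies outside A_p
    -- because a solution of f ≡ j (mod p) scales to one of f ≡ j·p^k (mod p^(k+1)).
    part-ii : 2 ℕ.* s ℕ.+ 2 ℕ.≤ k ℕ.+ 1 → ∀ b → InN c k p pp (k ℕ.+ 1) b →
      ∃ λ j → 0 ℕ.< j × j ℕ.< p × ¬ InA c k p j × b ≡ j ℕ.* p ℕ.^ k
    part-ii 2s+2≤k+1 b b∈N = j , 0<j , j<p , j∉Aₚ , b≡jpᵏ
      where
      level : ∃ λ e → k ℕ.+ 1 ≡ suc (s ℕ.+ suc (s ℕ.+ e))
      level = lifting-level s (k ℕ.+ 1) 2s+2≤k+1
      k≡m : k ≡ s ℕ.+ suc (s ℕ.+ proj₁ level)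
      k≡m = ℕP.suc-injective (trans (sym k+1≡1+k) (proj₂ level))
      digits : ∃ λ j → 0 ℕ.< j × j ℕ.< p × b ≡ j ℕ.* p ℕ.^ (s ℕ.+ suc (s ℕ.+ proj₁ level))
      digits = N-digits (proj₁ level) (ℕP.≤-reflexive (sym k≡m)) b (subst (λ n → InN c k p pp n b) (proj₂ level) b∈N)
      j : ℕ
      j = proj₁ digits
      0<j : 0 ℕ.< j
      0<j = proj₁ (proj₂ digits)
      j<p : j ℕ.< p
      j<p = proj₁ (proj₂ (proj₂ digits))
      b≡jpᵏ : b ≡ j ℕ.* p ℕ.^ k
      b≡jpᵏ = trans (proj₂ (proj₂ (proj₂ digits))) (cong (λ m → j ℕ.* p ℕ.^ m) (sym k≡m))
      j∉Aₚ : ¬ InA c k p j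
      j∉Aₚ j∈Aₚ = proj₂ b∈N (subst₂ (λ n v → InA c k (p ℕ.^ n) v) (sym k+1≡1+k) (sym b≡jpᵏ) (scale-solution c k j∈Aₚ))

    -- Part (iii): if some exponent of p in f divides k, every j·p^k with 0 < j < p and
    -- j ∉ A_p lies in N_{p^(k+1)}: it lies in A_{p^(k+1)}(p^k) as 0 + j·p^k, and not in
    -- A_{p^(k+1)} by exponent-excludes.
    part-iii : (∃ λ e → IsExponent c k p e × e ∣ₙ k) → ∀ b →
      (∃ λ j → 0 ℕ.< j × j ℕ.< p × ¬ InA c k p j × b ≡ j ℕ.* p ℕ.^ k) → InN c k p pp (k ℕ.+ 1) b
    part-iii (e , is-exp , e∣k) b (j , _ , j<p , j∉Aₚ , b≡jpᵏ) =
      subst (λ n → InN c k p pp n b) (sym k+1≡1+k) (b∈Aₚₖ₊₁[pᵏ] , b∉Aₚₖ₊₁)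
      where
      b∈Aₚₖ₊₁[pᵏ] : InAm c k (p ℕ.^ suc k) (p ℕ.^ k) {{ℕP.m^n≢0 p k}} b
      b∈Aₚₖ₊₁[pᵏ] = 0 , j , zero∈A c k (p ℕ.^ k) (ℕ.s≤s ℕ.z≤n) (ℕ.>-nonZero⁻¹ _ {{ℕP.m^n≢0 p k}})
                      , subst (j ℕ.<_) (sym (blocks p k)) j<p , b≡jpᵏ
      b∉Aₚₖ₊₁ : ¬ InA c k (p ℕ.^ suc k) b
      b∉Aₚₖ₊₁ = subst (λ v → ¬ InA c k (p ℕ.^ suc k) v) (sym b≡jpᵏ) (exponent-excludes c k is-exp e∣k j<p j∉Aₚ)

open import Defs
open import Data.Nat using (ℕ; zero; suc; _+_; _*_; _^_; _≤_; _<_; _∸_)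
open import Data.Nat.Divisibility using (_∣_)
open import Data.Nat.Primality using (Prime)
open import Data.Fin using (Fin)
open import Data.Integer using (ℤ; +_)
open import Data.Integer.Divisibility using () renaming (_∣_ to _∣ℤ_)
open import Data.Product using (∃; _×_; _,_)
open import Relation.Nullary using (¬_)
open import Relation.Binary.PropositionalEquality using (_≡_)
open DiagonalForms using (module Parts)

proposition2p12 :
    (t : ℕ) (c : Fin t → ℤ) (k : ℕ) → 1 ≤ k →
    (p : ℕ) (pp : Prime p) → (∀ i → ¬ ((+ p) ∣ℤ c i)) →
    (s : ℕ) → (p ^ s) ∣ k → ¬ ((p ^ suc s) ∣ k) →
    ((n : ℕ) → 2 * s + 2 ≤ n → n ≤ k + 1 →
      ∀ b → InN c k p pp n b → ∃ λ j → 0 < j × j < p × b ≡ j * p ^ (n ∸ 1))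
    ×
    (2 * s + 2 ≤ k + 1 →
      (∀ b → InN c k p pp (k + 1) b →
        ∃ λ j → 0 < j × j < p × ¬ InA c k p j × b ≡ j * p ^ k)
      ×
      ((∃ λ e → IsExponent c k p e × e ∣ k) →
        ∀ b → (InN c k p pp (k + 1) b →
                 ∃ λ j → 0 < j × j < p × ¬ InA c k p j × b ≡ j * p ^ k)
              × ((∃ λ j → 0 < j × j < p × ¬ InA c k p j × b ≡ j * p ^ k) →
                 InN c k p pp (k + 1) b)))
proposition2p12 t c zero () p pp p∤c s pˢ∣k pˢ⁺¹∤k
proposition2p12 t c (suc k₀) _ p pp p∤c s pˢ∣k pˢ⁺¹∤k =
  part-i , λ 2s+2≤k+1 → part-ii 2s+2≤k+1 , λ exponent b → part-ii 2s+2≤k+1 b , part-iii exponent b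
  where
  open Parts c k₀ pp s pˢ∣k pˢ⁺¹∤k p∤c
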